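{- Let $G=(V,E)$ be a directed graph, $s\in V$, $k\ge0$, and let $G'_s=(V'_s,E'_s)$ be the split graph defined in the context. Let $C'$ be a minimal $k$-edge-out component containing $s_{\mathrm{out}}$ in $G'_s$. Then $C=\{v\in V: v_{\mathrm{out}}\in C'\}$ is a $k$-vertex-out component containing $s$ in $G$ with $\operatorname{vol}^*(C)\le\operatorname{vol}'(C')$.
   Context: For a directed graph $H=(W,F)$ and $A,B\subseteq W$ let $F(A,B)=F\cap(A\times B)$. In $G$: a $k$-vertex-out component is a non-empty $C\subseteq V$ such that $B=\{v\in V\setminus C:\exists(u,v)\in E,u\in C\}$ has $|B|\le k$; $\operatorname{vol}^*(C)=|E(C,V)\cup E(V,C)|$. The graph $G'_s$: for every $v\in V\setminus\{s\}$ there are two vertices $v_{\mathrm{in}},v_{\mathrm{out}}$, and one additional vertex $s_{\mathrm{in}}=s_{\mathrm{out}}$; $E'_s=\{(v_{\mathrm{out}},w_{\mathrm{in}}):(v,w)\in E\}\cup\{(v_{\mathrm{in}},v_{\mathrm{out}}):v\in V\}$. A $k$-edge-out component of $G'_s$ is a non-empty $C'\subseteq V'_s$ with $|E'_s(C',V'_s\setminus C')|\le k$; it is minimal if every proper subset $\hat C\subsetneq C'$ has strictly more leaving edges than $C'$. For $C'\subseteq V'_s$ let $B'=\{v\in V'_s\setminus C':\exists u\in C',(u,v)\in E'_s\}$, $I'=C'\setminus\{v_{\mathrm{in}}:v_{\mathrm{out}}\in V'_s\setminus C'\}$, and $\operatorname{vol}'(C')=|E'_s(C',C')|+|E'_s(C',B')|+|E'_s(V'_s\setminus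 C',I')|$. -}

module Defs where

open import Data.Nat using (ℕ; _≤_; _<_; _+_)
open import Data.Bool using (Bool; true; false; _∧_; _∨_; not; if_then_else_)
import Data.Bool.Properties as BoolP
open import Data.Fin using (Fin; _≟_)
open import Data.Bool.ListAction using (any)
open import Data.List using (List; length; filterᵇ; allFin; cartesianProduct; _∷_; [])
open import Data.Product using (Σ; ∃; _×_; _,_; proj₁; proj₂)
open import Data.Product.Properties using (≡-dec)
open import Relation.Nullary.Decidable using (⌊_⌋)
open import Relation.Binary.PropositionalEquality using (_≡_)

-- A finite directed graph H = (W, F) is given by a duplicate-free list W of
-- its vertices (drawn from some type X) and a Boolean edge relation F
-- (F a b ≡ true  iff  (a , b) is an edge).  Subsets of W are Boolean
-- predicates on X; all counting is done over the list W, so complements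
-- are taken relative to W.

Subset : Set → Set
Subset X = X → Bool

EdgeRel : Set → Set
EdgeRel X = X → X → Bool

countEdges : {X : Set} → List X → EdgeRel X → (X → X → Bool) → ℕ
countEdges W F P =
  length (filterᵇ (λ p → F (proj₁ p) (proj₂ p) ∧ P (proj₁ p) (proj₂ p))
                  (cartesianProduct W W))

edgesBetween : {X : Set} → List X → EdgeRel X → Subset X → Subset X → ℕ
edgesBetween W F A B = countEdges W F (λ a b → A a ∧ B b)

card : {X : Set} → List X → Subset X → ℕ
card W A = length (filterᵇ A W)

V : (n : ℕ) → List (Fin n)
V n = allFin n

outBoundary : (n : ℕ) → EdgeRel (Fin n) → Subset (Fin n) → Subset (Fin n)
outBoundary n E C v = not (C v) ∧ any (λ u → C u ∧ E u v) (V n)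

IsVertexOutComponent : (n : ℕ) → EdgeRel (Fin n) → ℕ → Subset (Fin n) → Set
IsVertexOutComponent n E k C =
  (∃ λ v → C v ≡ true) × (card (V n) (outBoundary n E C) ≤ k)

volStar : (n : ℕ) → EdgeRel (Fin n) → Subset (Fin n) → ℕ
volStar n E C = countEdges (V n) E (λ u v → C u ∨ C v)

-- Encoding: vertices of G'_s are elements of Fin n × Bool.
--   v_out = (v , true)                       for every v
--   v_in  = (v , false)                      for v ≠ s
--   s_in  = s_out = (s , true)
-- The element (s , false) is not a vertex of G'_s (it is not in V'_s).

Node : ℕ → Set
Node n = Fin n × Bool

_==_ : {n : ℕ} → Node n → Node n → Bool
x == y = ⌊ ≡-dec _≟_ BoolP._≟_ x y ⌋

vout : {n : ℕ} → Fin n → Node n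
vout v = (v , true)

vin : {n : ℕ} → Fin n → Fin n → Node n
vin s v = if ⌊ v ≟ s ⌋ then (s , true) else (v , false)

inV' : (n : ℕ) → Fin n → Subset (Node n)
inV' n s x = any (λ v → (x == vin s v) ∨ (x == vout v)) (V n)

V' : (n : ℕ) → Fin n → List (Node n)
V' n s = filterᵇ (inV' n s) (cartesianProduct (V n) (true ∷ false ∷ []))

E' : (n : ℕ) → EdgeRel (Fin n) → Fin n → EdgeRel (Node n)
E' n E s x y =
  any (λ p → E (proj₁ p) (proj₂ p) ∧ (x == vout (proj₁ p)) ∧ (y == vin s (proj₂ p)))
      (cartesianProduct (V n) (V n))
  ∨ any (λ v → (x == vin s v) ∧ (y == vout v)) (V n)

leaving : (n : ℕ) → EdgeRel (Fin n) → Fin n → Subset (Node n) → ℕ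
leaving n E s C' = edgesBetween (V' n s) (E' n E s) C' (λ x → not (C' x))

IsEdgeOutComponent : (n : ℕ) → EdgeRel (Fin n) → Fin n → ℕ → Subset (Node n) → Set
IsEdgeOutComponent n E s k C' =
  (∀ x → C' x ≡ true → inV' n s x ≡ true)
  × (∃ λ x → C' x ≡ true)
  × (leaving n E s C' ≤ k)

IsMinimalEdgeOutComponent : (n : ℕ) → EdgeRel (Fin n) → Fin n → ℕ → Subset (Node n) → Set
IsMinimalEdgeOutComponent n E s k C' =
  IsEdgeOutComponent n E s k C'
  × (∀ (Ĉ : Subset (Node n))
       → (∀ x → Ĉ x ≡ true → C' x ≡ true)
       → (∃ λ x → (C' x ≡ true) × (Ĉ x ≡ false))
       → (∃ λ x → Ĉ x ≡ true)
       → leaving n E s C' < leaving n E s Ĉ)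

B' : (n : ℕ) → EdgeRel (Fin n) → Fin n → Subset (Node n) → Subset (Node n)
B' n E s C' x =
  inV' n s x ∧ not (C' x) ∧ any (λ u → C' u ∧ E' n E s u x) (V' n s)

I' : (n : ℕ) → Fin n → Subset (Node n) → Subset (Node n)
I' n s C' x =
  C' x ∧ not (any (λ v → (x == vin s v) ∧ inV' n s (vout v) ∧ not (C' (vout v))) (V n))

vol' : (n : ℕ) → EdgeRel (Fin n) → Fin n → Subset (Node n) → ℕ
vol' n E s C' =
  edgesBetween (V' n s) (E' n E s) C' C'
  + edgesBetween (V' n s) (E' n E s) C' (B' n E s C')
  + edgesBetween (V' n s) (E' n E s) (λ x → not (C' x)) (I' n s C')

projectOut : {n : ℕ} → Subset (Node n) → Subset (Fin n)
projectOut C' v = C' (vout v)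

--   * Boundary.  For every subset D of V'_s, each out-neighbour w ∉ C of C is
--     the head (lying over w) of some edge leaving D: the internal edge
--     w_in → w_out if w_in ∈ D, otherwise a split edge u_out → w_in.  Hence
--     |B| ≤ |E'_s(D, V'_s ∖ D)|, and for D = C' this is at most k.
--   * No gap.  For v ≠ s the only edge entering v_out comes from v_in, so if
--     v_out ∈ C' but v_in ∉ C', deleting v_out from C' creates no new leaving
--     edge; this contradicts minimality.  So v_out ∈ C' implies v_in ∈ C'.
--   * Volume.  Under the no-gap property, u ↦ u_out, v ↦ v_in maps the edges
--     of G touching C injectively to edges of G'_s counted by vol'(C').

module Submission where

open import Defs
open import Data.Nat using (ℕ; _≤_; _<_; _+_; suc; z≤n; s≤s)
open import Data.Nat.Properties
  using (module ≤-Reasoning; ≤-refl; ≤-trans; ≤-reflexive; <-≤-trans; <-irrefl;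
         +-mono-≤; +-monoʳ-≤; +-suc; m≤n⇒m≤1+n; n≤1+n)
open import Data.Bool using (Bool; true; false; _∧_; _∨_; not)
open import Data.Bool.Properties
  using (∧-conicalˡ; ∧-conicalʳ; ∧-zeroʳ; ∨-zeroʳ; ∧-distribˡ-∨; not-¬; ¬-not; T-≡)
import Data.Bool.Properties as BoolP
open import Data.Bool.ListAction using (any)
open import Data.Fin using (Fin; _≟_)
open import Data.List using (List; []; _∷_; _++_; length; filterᵇ; cartesianProduct)
open import Data.List.Properties using (length-++)
open import Data.List.Membership.Propositional using (_∈_; lose)
open import Data.List.Membership.Propositional.Properties
  using (∈-filter⁺; ∈-filter⁻; ∈-cartesianProduct⁺; ∈-cartesianProduct⁻; ∈-allFin;
         ∈-∃++; ∈-++⁻; ∈-++⁺ˡ; ∈-++⁺ʳ)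
open import Data.List.Relation.Unary.Any using (here; there; satisfied)
open import Data.List.Relation.Unary.Any.Properties using (any⁺; any⁻)
open import Data.List.Relation.Unary.All using (lookup)
open import Data.List.Relation.Unary.AllPairs using (_∷_)
open import Data.List.Relation.Unary.Unique.Propositional using (Unique)
import Data.List.Relation.Unary.Unique.Propositional.Properties as Unique
open import Data.Product using (_×_; _,_; proj₁; proj₂; ∃)
open import Data.Product.Properties using (≡-dec; ,-injectiveˡ; ,-injectiveʳ)
open import Data.Sum using (_⊎_; inj₁; inj₂)
open import Data.Empty using (⊥-elim)
open import Function.Bundles using (Equivalence)
open import Relation.Nullary using (yes; no)
open import Relation.Nullary.Decidable using (T?; isYes≗does; dec-true; dec-false; toWitness)
open import Relation.Binary.PropositionalEquality using (_≡_; _≢_; refl; sym; trans; cong; subst)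

open ≤-Reasoning

∧-intro : ∀ {a b} → a ≡ true → b ≡ true → a ∧ b ≡ true
∧-intro refl refl = refl

∨-introˡ : ∀ {a} b → a ≡ true → a ∨ b ≡ true
∨-introˡ b refl = refl

∨-introʳ : ∀ a {b} → b ≡ true → a ∨ b ≡ true
∨-introʳ a refl = ∨-zeroʳ a

∨-elim : ∀ a {b} → a ∨ b ≡ true → a ≡ true ⊎ b ≡ true
∨-elim true  _ = inj₁ refl
∨-elim false h = inj₂ h

-- case split on a Boolean without abstracting it in the goal
true-or-false : ∀ b → b ≡ true ⊎ b ≡ false
true-or-false true  = inj₁ refl
true-or-false false = inj₂ refl

not-intro : ∀ {a} → a ≡ false → not a ≡ true
not-intro = cong not

not-elim : ∀ {a} → not a ≡ true → a ≡ false
not-elim {false} _ = refl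

not-and-not : ∀ {d x} → not (d ∧ not x) ≡ true → d ≡ true → x ≡ true
not-and-not {true} {true} _ _ = refl

any-intro : ∀ {A : Set} (p : A → Bool) {x : A} {xs : List A} → x ∈ xs → p x ≡ true → any p xs ≡ true
any-intro p x∈xs px = Equivalence.to T-≡ (any⁺ p (lose x∈xs (Equivalence.from T-≡ px)))

any-elim : ∀ {A : Set} (p : A → Bool) (xs : List A) → any p xs ≡ true → ∃ λ x → p x ≡ true
any-elim p xs h with x , px ← satisfied (any⁻ p xs (Equivalence.from T-≡ h)) = x , Equivalence.to T-≡ px

∈-filterᵇ⁺ : ∀ {A : Set} (p : A → Bool) {x : A} {xs : List A}
  → x ∈ xs → p x ≡ true → x ∈ filterᵇ p xs
∈-filterᵇ⁺ p x∈xs px = ∈-filter⁺ (λ a → T? (p a)) x∈xs (Equivalence.from T-≡ px)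

∈-filterᵇ⁻ : ∀ {A : Set} (p : A → Bool) {x : A} {xs : List A} → x ∈ filterᵇ p xs → x ∈ xs × p x ≡ true
∈-filterᵇ⁻ p x∈ with x∈xs , px ← ∈-filter⁻ (λ a → T? (p a)) x∈ = x∈xs , Equivalence.to T-≡ px

length-filter-mono : ∀ {A : Set} {p q : A → Bool} → (∀ x → p x ≡ true → q x ≡ true)
  → (xs : List A) → length (filterᵇ p xs) ≤ length (filterᵇ q xs)
length-filter-mono p⇒q [] = z≤n
length-filter-mono {p = p} {q} p⇒q (x ∷ xs) with p x in px | q x in qx
... | true  | true  = s≤s (length-filter-mono p⇒q xs)
... | true  | false = ⊥-elim (not-¬ qx (p⇒q x px))
... | false | true  = m≤n⇒m≤1+n (length-filter-mono p⇒q xs)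
... | false | false = length-filter-mono p⇒q xs

length-filter-∨ : ∀ {A : Set} (p q : A → Bool) (xs : List A)
  → length (filterᵇ (λ x → p x ∨ q x) xs) ≤ length (filterᵇ p xs) + length (filterᵇ q xs)
length-filter-∨ p q [] = z≤n
length-filter-∨ p q (x ∷ xs) with p x | q x
... | true  | true  = s≤s (≤-trans (length-filter-∨ p q xs) (+-monoʳ-≤ (length (filterᵇ p xs)) (n≤1+n _)))
... | true  | false = s≤s (length-filter-∨ p q xs)
... | false | true  = ≤-trans (s≤s (length-filter-∨ p q xs)) (≤-reflexive (sym (+-suc _ _)))
... | false | false = length-filter-∨ p q xs

-- Counting by witnesses: if every element of a duplicate-free list xs has an
-- R-witness in ys and no y witnesses two different elements, then
-- |xs| ≤ |ys|.  (Remove the head's witness from ys and recurse.)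
length-≤-by-witnesses : ∀ {A B : Set} (R : A → B → Set) {xs : List A} {ys : List B}
  → Unique xs
  → (∀ {x} → x ∈ xs → ∃ λ y → y ∈ ys × R x y)
  → (∀ {x x' y} → R x y → R x' y → x ≡ x')
  → length xs ≤ length ys
length-≤-by-witnesses R {[]} _ _ _ = z≤n
length-≤-by-witnesses R {x ∷ xs} (x∉xs ∷ uniq) witness functional
  with y , y∈ys , rxy ← witness (here refl)
  with ys₁ , ys₂ , refl ← ∈-∃++ y∈ys
  = ≤-trans (s≤s (length-≤-by-witnesses R uniq witness′ functional)) (≤-reflexive length-insert)
  where
  -- the witness of any x' ∈ xs is not y, for y already witnesses x ≠ x'
  witness′ : ∀ {x'} → x' ∈ xs → ∃ λ y' → y' ∈ ys₁ ++ ys₂ × R x' y'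
  witness′ x'∈xs with y' , y'∈ , r ← witness (there x'∈xs) | ∈-++⁻ ys₁ y'∈
  ... | inj₁ y'∈ys₁         = y' , ∈-++⁺ˡ y'∈ys₁ , r
  ... | inj₂ (there y'∈ys₂) = y' , ∈-++⁺ʳ ys₁ y'∈ys₂ , r
  ... | inj₂ (here refl)    = ⊥-elim (lookup x∉xs x'∈xs (functional rxy r))
  length-insert : suc (length (ys₁ ++ ys₂)) ≡ length (ys₁ ++ y ∷ ys₂)
  length-insert = trans (cong suc (length-++ ys₁))
                    (trans (sym (+-suc (length ys₁) (length ys₂))) (sym (length-++ ys₁)))

countEdges-mono : ∀ {X : Set} (W : List X) (F : EdgeRel X) {P Q : X → X → Bool}
  → (∀ a b → F a b ≡ true → P a b ≡ true → Q a b ≡ true)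
  → countEdges W F P ≤ countEdges W F Q
countEdges-mono W F {P} {Q} P⇒Q = length-filter-mono weaken (cartesianProduct W W)
  where
  weaken : ∀ e → F (proj₁ e) (proj₂ e) ∧ P (proj₁ e) (proj₂ e) ≡ true
               → F (proj₁ e) (proj₂ e) ∧ Q (proj₁ e) (proj₂ e) ≡ true
  weaken (a , b) h = ∧-intro edge (P⇒Q a b edge (∧-conicalʳ (F a b) _ h))
    where edge = ∧-conicalˡ (F a b) _ h

countEdges-∨ : ∀ {X : Set} (W : List X) (F : EdgeRel X) (P Q : X → X → Bool)
  → countEdges W F (λ a b → P a b ∨ Q a b) ≤ countEdges W F P + countEdges W F Q
countEdges-∨ W F P Q = ≤-trans (length-filter-mono distribute (cartesianProduct W W))
                                (length-filter-∨ _ _ (cartesianProduct W W))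
  where
  distribute : ∀ e → F (proj₁ e) (proj₂ e) ∧ (P (proj₁ e) (proj₂ e) ∨ Q (proj₁ e) (proj₂ e)) ≡ true
    → (F (proj₁ e) (proj₂ e) ∧ P (proj₁ e) (proj₂ e))
        ∨ (F (proj₁ e) (proj₂ e) ∧ Q (proj₁ e) (proj₂ e)) ≡ true
  distribute (a , b) h = trans (sym (∧-distribˡ-∨ (F a b) (P a b) (Q a b))) h

countEdges-≤-along : ∀ {X Y : Set} {W : List X} {F P : EdgeRel X} {W' : List Y} {F' P' : EdgeRel Y}
  (σ τ : X → Y) → Unique W
  → (∀ {a a'} → σ a ≡ σ a' → a ≡ a') → (∀ {b b'} → τ b ≡ τ b' → b ≡ b')
  → (∀ {a} → a ∈ W → σ a ∈ W') → (∀ {b} → b ∈ W → τ b ∈ W')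
  → (∀ a b → F a b ∧ P a b ≡ true → F' (σ a) (τ b) ∧ P' (σ a) (τ b) ≡ true)
  → countEdges W F P ≤ countEdges W' F' P'
countEdges-≤-along {X} {Y} {W} {F} {P} {W'} {F'} {P'} σ τ uniq σ-inj τ-inj σ∈ τ∈ preserve =
  length-≤-by-witnesses (λ e e' → e' ≡ image e)
    (Unique.filter⁺ (λ e → T? (Counted e)) (Unique.cartesianProduct⁺ uniq uniq))
    witness image-injective
  where
  Counted : X × X → Bool
  Counted e = F (proj₁ e) (proj₂ e) ∧ P (proj₁ e) (proj₂ e)
  Counted' : Y × Y → Bool
  Counted' e = F' (proj₁ e) (proj₂ e) ∧ P' (proj₁ e) (proj₂ e)
  image : X × X → Y × Y
  image (a , b) = σ a , τ b
  image-injective : ∀ {e e' f} → f ≡ image e → f ≡ image e' → e ≡ e'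
  image-injective {a , b} {a' , b'} refl eq
    with refl ← σ-inj (,-injectiveˡ eq) | refl ← τ-inj (,-injectiveʳ eq) = refl
  witness : ∀ {e} → e ∈ filterᵇ Counted (cartesianProduct W W)
    → ∃ λ f → f ∈ filterᵇ Counted' (cartesianProduct W' W') × f ≡ image e
  witness {a , b} e∈ with e∈W² , counted ← ∈-filterᵇ⁻ Counted e∈
                     with a∈W , b∈W ← ∈-cartesianProduct⁻ W W e∈W²
    = image (a , b)
    , ∈-filterᵇ⁺ Counted' (∈-cartesianProduct⁺ (σ∈ a∈W) (τ∈ b∈W)) (preserve a b counted)
    , refl

module SplitGraph (n : ℕ) (E : EdgeRel (Fin n)) (s : Fin n) where

  ==-refl : (x : Node n) → (x == x) ≡ true
  ==-refl x = trans (isYes≗does x≟x) (dec-true x≟x refl)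
    where x≟x = ≡-dec _≟_ BoolP._≟_ x x

  ==-false : {x y : Node n} → x ≢ y → (x == y) ≡ false
  ==-false {x} {y} x≢y = trans (isYes≗does x≟y) (dec-false x≟y x≢y)
    where x≟y = ≡-dec _≟_ BoolP._≟_ x y

  ==-sound : (x y : Node n) → (x == y) ≡ true → x ≡ y
  ==-sound x y h = toWitness {a? = ≡-dec _≟_ BoolP._≟_ x y} (Equivalence.from T-≡ h)

  -- v_in lies over v (for v = s it is s_out, which also lies over s).
  vin-over : ∀ v → proj₁ (vin s v) ≡ v
  vin-over v with v ≟ s
  ... | yes refl = refl
  ... | no _     = refl

  vin-injective : ∀ {v w} → vin s v ≡ vin s w → v ≡ w
  vin-injective {v} {w} eq = trans (sym (vin-over v)) (trans (cong proj₁ eq) (vin-over w))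

  vout-injective : ∀ {v w : Fin n} → vout v ≡ vout w → v ≡ w
  vout-injective = ,-injectiveˡ

  vin-s : vin s s ≡ vout s
  vin-s with s ≟ s
  ... | yes _   = refl
  ... | no s≢s  = ⊥-elim (s≢s refl)

  vout≡vin⇒s : ∀ {v w} → vout w ≡ vin s v → w ≡ s
  vout≡vin⇒s {v} eq with v ≟ s
  ... | yes _ = ,-injectiveˡ eq
  ... | no _  with () ← ,-injectiveʳ eq

  inV'⇒∈V' : ∀ x → inV' n s x ≡ true → x ∈ V' n s
  inV'⇒∈V' (v , b) = ∈-filterᵇ⁺ (inV' n s) (∈-cartesianProduct⁺ (∈-allFin v) (bool∈ b))
    where
    bool∈ : ∀ b → b ∈ true ∷ false ∷ []
    bool∈ true  = here refl
    bool∈ false = there (here refl)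

  vout-inV' : ∀ v → inV' n s (vout v) ≡ true
  vout-inV' v = any-intro (λ w → (vout v == vin s w) ∨ (vout v == vout w)) (∈-allFin v)
                          (∨-introʳ _ (==-refl (vout v)))

  vin-inV' : ∀ v → inV' n s (vin s v) ≡ true
  vin-inV' v = any-intro (λ w → (vin s v == vin s w) ∨ (vin s v == vout w)) (∈-allFin v)
                         (∨-introˡ _ (==-refl (vin s v)))

  vout∈V' : ∀ v → vout v ∈ V' n s
  vout∈V' v = inV'⇒∈V' _ (vout-inV' v)

  vin∈V' : ∀ v → vin s v ∈ V' n s
  vin∈V' v = inV'⇒∈V' _ (vin-inV' v)

  split-edge : ∀ {u v} → E u v ≡ true → E' n E s (vout u) (vin s v) ≡ true
  split-edge {u} {v} e = ∨-introˡ _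
    (any-intro (λ p → E (proj₁ p) (proj₂ p) ∧ (vout u == vout (proj₁ p)) ∧ (vin s v == vin s (proj₂ p)))
               (∈-cartesianProduct⁺ (∈-allFin u) (∈-allFin v))
               (∧-intro e (∧-intro (==-refl (vout u)) (==-refl (vin s v)))))

  internal-edge : ∀ v → E' n E s (vin s v) (vout v) ≡ true
  internal-edge v = ∨-introʳ _
    (any-intro (λ w → (vin s v == vin s w) ∧ (vout v == vout w)) (∈-allFin v)
               (∧-intro (==-refl (vin s v)) (==-refl (vout v))))

  into-vout : ∀ {x w} → w ≢ s → E' n E s x (vout w) ≡ true → x ≡ vin s w
  into-vout {x} {w} w≢s h with ∨-elim _ h
  ... | inj₁ split
    with (u , v) , p ← any-elim (λ p → E (proj₁ p) (proj₂ p) ∧ (x == vout (proj₁ p))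
                                                           ∧ (vout w == vin s (proj₂ p)))
                                (cartesianProduct (V n) (V n)) split
    = ⊥-elim (w≢s (vout≡vin⇒s (==-sound (vout w) (vin s v)
                                 (∧-conicalʳ (x == vout u) _ (∧-conicalʳ (E u v) _ p)))))
  ... | inj₂ internal
    with v , p ← any-elim (λ v → (x == vin s v) ∧ (vout w == vout v)) (V n) internal
    with refl ← ,-injectiveˡ (==-sound (vout w) (vout v) (∧-conicalʳ (x == vin s v) _ p))
    = ==-sound x (vin s v) (∧-conicalˡ (x == vin s v) _ p)

  Leaves : Subset (Node n) → Node n × Node n → Bool
  Leaves D e = E' n E s (proj₁ e) (proj₂ e) ∧ (D (proj₁ e) ∧ not (D (proj₂ e)))

  leaving-edge∈ : ∀ {D x y} → x ∈ V' n s → y ∈ V' n s → E' n E s x y ≡ true → D x ≡ true → D y ≡ false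
    → (x , y) ∈ filterᵇ (Leaves D) (cartesianProduct (V' n s) (V' n s))
  leaving-edge∈ x∈ y∈ e x∈D y∉D =
    ∈-filterᵇ⁺ _ (∈-cartesianProduct⁺ x∈ y∈) (∧-intro e (∧-intro x∈D (not-intro y∉D)))

  -- An out-neighbour w ∉ C of C = projectOut D heads an edge leaving D lying over w:
  -- w_in → w_out if w_in ∈ D, and u_out → w_in for the in-neighbour u ∈ C otherwise.
  boundary-witness : ∀ D {w} → outBoundary n E (projectOut D) w ≡ true
    → ∃ λ e → e ∈ filterᵇ (Leaves D) (cartesianProduct (V' n s) (V' n s)) × proj₁ (proj₂ e) ≡ w
  boundary-witness D {w} h
    with u , u∈C∧uw ← any-elim (λ u → D (vout u) ∧ E u w) (V n) (∧-conicalʳ (not (D (vout w))) _ h)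
    with D (vin s w) in win
  ... | true  = (vin s w , vout w)
              , leaving-edge∈ {D} (vin∈V' w) (vout∈V' w) (internal-edge w) win
                               (not-elim (∧-conicalˡ (not (D (vout w))) _ h))
              , refl
  ... | false = (vout u , vin s w)
              , leaving-edge∈ {D} (vout∈V' u) (vin∈V' w) (split-edge (∧-conicalʳ (D (vout u)) _ u∈C∧uw))
                               (∧-conicalˡ (D (vout u)) _ u∈C∧uw) win
              , vin-over w

  -- Distinct boundary vertices give distinct leaving edges (their heads lie over them).
  boundary-bound : ∀ D → card (V n) (outBoundary n E (projectOut D)) ≤ leaving n E s D
  boundary-bound D =
    length-≤-by-witnesses (λ w e → proj₁ (proj₂ e) ≡ w)
      (Unique.filter⁺ (λ w → T? (outBoundary n E (projectOut D) w)) (Unique.allFin⁺ n))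
      (λ w∈ → boundary-witness D (proj₂ (∈-filterᵇ⁻ (outBoundary n E (projectOut D)) {xs = V n} w∈)))
      (λ over-w over-w' → trans (sym over-w) over-w')

  without : Subset (Node n) → Node n → Subset (Node n)
  without D x y = D y ∧ not (y == x)

  -- If v ≠ s and v_in ∉ D, deleting v_out from D creates no new leaving edge,
  -- since the only edge entering v_out starts at v_in.
  leaving-without-vout : ∀ D {v} → v ≢ s → D (vin s v) ≡ false
    → leaving n E s (without D (vout v)) ≤ leaving n E s D
  leaving-without-vout D {v} v≢s vin∉D = countEdges-mono (V' n s) (E' n E s) still-leaves
    where
    still-leaves : ∀ a b → E' n E s a b ≡ true
      → without D (vout v) a ∧ not (without D (vout v) b) ≡ true → D a ∧ not (D b) ≡ true
    still-leaves a b e h = ∧-intro a∈D (not-intro (¬-not b∉D))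
      where
      a∈D : D a ≡ true
      a∈D = ∧-conicalˡ (D a) _ (∧-conicalˡ (without D (vout v) a) _ h)
      b∉D : D b ≢ true
      b∉D b∈D with refl ← ==-sound b (vout v) (not-and-not (∧-conicalʳ (without D (vout v) a) _ h) b∈D)
        = not-¬ vin∉D (subst (λ x → D x ≡ true) (into-vout v≢s e) a∈D)

  NoGap : Subset (Node n) → Set
  NoGap D = ∀ v → D (vout v) ≡ true → D (vin s v) ≡ true

  -- A minimal component containing s_out has no gap: otherwise deleting v_out
  -- would give a smaller non-empty subset with no more leaving edges.
  minimal-no-gap : ∀ {k C'} → IsMinimalEdgeOutComponent n E s k C' → C' (vout s) ≡ true → NoGap C'
  minimal-no-gap {C' = C'} (_ , minimal) s∈C' v vout∈C' with C' (vin s v) in vin∉C'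
  ... | true  = refl
  ... | false = ⊥-elim (<-irrefl refl (<-≤-trans more-leaving (leaving-without-vout C' v≢s vin∉C')))
    where
    Ĉ : Subset (Node n)
    Ĉ = without C' (vout v)
    v≢s : v ≢ s
    v≢s refl = not-¬ vin∉C' (trans (cong C' vin-s) s∈C')
    Ĉ⊆C' : ∀ x → Ĉ x ≡ true → C' x ≡ true
    Ĉ⊆C' x = ∧-conicalˡ (C' x) _
    vout∉Ĉ : Ĉ (vout v) ≡ false
    vout∉Ĉ = trans (cong (λ b → C' (vout v) ∧ not b) (==-refl (vout v))) (∧-zeroʳ _)
    vout-s∈Ĉ : Ĉ (vout s) ≡ true
    vout-s∈Ĉ = ∧-intro s∈C' (not-intro (==-false (λ eq → v≢s (sym (vout-injective eq)))))
    more-leaving : leaving n E s C' < leaving n E s Ĉ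
    more-leaving = minimal Ĉ Ĉ⊆C' (vout v , vout∈C' , vout∉Ĉ) (vout s , vout-s∈Ĉ)

  Inside Outgoing Incoming : Subset (Node n) → Node n → Node n → Bool
  Inside   D a b = D a ∧ D b
  Outgoing D a b = D a ∧ B' n E s D b
  Incoming D a b = not (D a) ∧ I' n s D b

  VolEdge : Subset (Node n) → Node n → Node n → Bool
  VolEdge D a b = (Inside D a b ∨ Outgoing D a b) ∨ Incoming D a b

  head-in-D-or-B' : ∀ D {x y} → x ∈ V' n s → inV' n s y ≡ true → D x ≡ true
    → E' n E s x y ≡ true → D y ∨ B' n E s D y ≡ true
  head-in-D-or-B' D {y = y} x∈ y∈ x∈D e with true-or-false (D y)
  ... | inj₁ y∈D = ∨-introˡ _ y∈D
  ... | inj₂ y∉D = ∨-introʳ (D y)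
        (∧-intro y∈ (∧-intro (not-intro y∉D) (any-intro (λ u → D u ∧ E' n E s u y) x∈ (∧-intro x∈D e))))

  I'-vin : ∀ D {v} → D (vout v) ≡ true → D (vin s v) ≡ true → I' n s D (vin s v) ≡ true
  I'-vin D {v} vout∈D vin∈D = ∧-intro vin∈D (not-intro (¬-not no-cut))
    where
    cuts : Fin n → Bool
    cuts w = (vin s v == vin s w) ∧ inV' n s (vout w) ∧ not (D (vout w))
    no-cut : any cuts (V n) ≢ true
    no-cut h with w , p ← any-elim cuts (V n) h
             with refl ← vin-injective (==-sound (vin s v) (vin s w) (∧-conicalˡ (vin s v == vin s w) _ p))
      = not-¬ (not-elim (∧-conicalʳ (inV' n s (vout w)) _ (∧-conicalʳ (vin s v == vin s w) _ p))) vout∈D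

  split-edge-counted : ∀ D → NoGap D → ∀ {u v} → E u v ≡ true → D (vout u) ∨ D (vout v) ≡ true
    → VolEdge D (vout u) (vin s v) ≡ true
  split-edge-counted D no-gap {u} {v} e touches with D (vout u) in uout
  ... | true  = ∨-introˡ _ (head-in-D-or-B' D (vout∈V' u) (vin-inV' v) uout (split-edge e))
  ... | false = I'-vin D touches (no-gap v touches)

  volume-bound : ∀ D → NoGap D → volStar n E (projectOut D) ≤ vol' n E s D
  volume-bound D no-gap = begin
      volStar n E (projectOut D)
    ≤⟨ countEdges-≤-along {F = E} {P = λ u v → D (vout u) ∨ D (vout v)} {F' = E' n E s} {P' = VolEdge D}
         vout (vin s) (Unique.allFin⁺ n) vout-injective vin-injective
         (λ {a} _ → vout∈V' a) (λ {b} _ → vin∈V' b) counted ⟩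
      countEdges (V' n s) (E' n E s) (VolEdge D)
    ≤⟨ countEdges-∨ (V' n s) (E' n E s) (λ a b → Inside D a b ∨ Outgoing D a b) (Incoming D) ⟩
      countEdges (V' n s) (E' n E s) (λ a b → Inside D a b ∨ Outgoing D a b)
        + countEdges (V' n s) (E' n E s) (Incoming D)
    ≤⟨ +-mono-≤ (countEdges-∨ (V' n s) (E' n E s) (Inside D) (Outgoing D)) ≤-refl ⟩
      vol' n E s D ∎
    where
    counted : ∀ u v → E u v ∧ (D (vout u) ∨ D (vout v)) ≡ true
      → E' n E s (vout u) (vin s v) ∧ VolEdge D (vout u) (vin s v) ≡ true
    counted u v h = ∧-intro (split-edge edge) (split-edge-counted D no-gap edge (∧-conicalʳ (E u v) _ h))
      where edge = ∧-conicalˡ (E u v) _ h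

lemma14 : (n : ℕ) (E : Fin n → Fin n → Bool) (s : Fin n) (k : ℕ)
    (C' : Node n → Bool)
    → IsMinimalEdgeOutComponent n E s k C'
    → C' (vout s) ≡ true
    → IsVertexOutComponent n E k (projectOut C')
    × projectOut C' s ≡ true
    × volStar n E (projectOut C') ≤ vol' n E s C'
lemma14 n E s k C' minimal s∈C' =
    ((s , s∈C') , ≤-trans (boundary-bound C') leaving≤k)
  , s∈C'
  , volume-bound C' (minimal-no-gap minimal s∈C')
  where
  open SplitGraph n E s
  leaving≤k : leaving n E s C' ≤ k
  leaving≤k = proj₂ (proj₂ (proj₁ minimal))
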